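{- For every radius $r$ and graph $G$: if Separator wins the Separation game of radius $r$ on $G$ in at most $k$ rounds, then Pseudo-Flipper wins the Pseudo-Flipper game of radius $r$ on $G$ in at most $2^{k+1}$ rounds.
   Context: For a partition $\mathcal P$ of $V(G)$, a $\mathcal P$-flip of $G$ is obtained by choosing a set of unordered pairs $\{P,Q\}$ of parts ($P=Q$ allowed) and complementing the adjacency between all distinct $u\in P,w\in Q$. For finite $S\subseteq V(G)$, the $S$-classes partition $V(G)$: two vertices are in the same class iff they are equal or both outside $S$ with the same neighbours in $S$; $S$-flips are flips w.r.t. this partition. $w,c$ are $r$-separated over $\mathcal P$ (resp. over $S$) if some $\mathcal P$-flip (resp. $S$-flip) $H$ of $G$ has $\mathrm{dist}_H(w,c)>r$; $B^r_{\mathcal P}(c)$ is the set of $w$ not $r$-separated from $c$ over $\mathcal P$. All flips and distances are in the original graph $G$. Separation game of radius $r$: $A_0=V(G)$, $S_0=\emptyset$; in round $k\ge1$: if $|A_{k-1}|=1$ Separator wins; else Connector picks $c_k\in A_{k-1}$, $A_k:=A_{k-1}\setminus\{w: w,c_k$ $r$-separated over $S_{k-1}\}$; Separator picks $s_k\in V(G)$, $S_k:=S_{k-1}\cup\{s_k\}$. Pseudo-Flipper game of radius $r$: $A_0=V(G)$, $\mathcal F_0=\{V(G)\}$; in round $k\ge1$: if $|A_{k-1}|=1$ Pseudo-Flipper wins; else Connector picks $c_k\in A_{k-1}$, $A_k:=A_{k-1}\cap B^r_{\mathcal F_{k-1}}(c_k)$; then Pseudo-Flipper obtains $\mathcal F_k$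 from $\mathcal F_{k-1}$ by splitting one part into two non-empty disjoint parts. -}

module Defs where

open import Level using (0ℓ)
open import Data.Nat using (ℕ; zero; suc; _^_; _+_; _≤_)
open import Data.Fin using (Fin)
open import Data.Bool using (Bool; true; false; _xor_)
open import Data.List using (List; _∷_; [])
open import Data.List.Membership.Propositional using (_∈_)
open import Data.Product using (Σ; ∃; ∃-syntax; _×_; _,_)
open import Data.Sum using (_⊎_)
open import Relation.Nullary using (¬_)
open import Relation.Binary.PropositionalEquality using (_≡_)

record Graph (n : ℕ) : Set where
  field
    adj   : Fin n → Fin n → Bool
    sym   : ∀ u v → adj u v ≡ adj v u
    irrefl : ∀ u → adj u u ≡ false
open Graph public

VSet : ℕ → Set₁
VSet n = Fin n → Set

Singleton : ∀ {n} → VSet n → Set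
Singleton {n} A = Σ (Fin n) λ a → A a × (∀ b → A b → b ≡ a)

-- A partition of V is given by its "same part" relation R.
-- A flip w.r.t. R is given by a symmetric 0/1 matrix F on vertices
-- that is constant on pairs of parts: F u v = true means the pair of
-- parts {[u],[v]} is flipped.  The flipped graph has adjacency
-- adj u v xor F u v  (for u ≠ v; loops are irrelevant for distances).

IsFlip : ∀ {n} → (Fin n → Fin n → Set) → (Fin n → Fin n → Bool) → Set
IsFlip {n} R F =
  (∀ u v → F u v ≡ F v u) ×
  (∀ u u' v v' → R u u' → R v v' → F u v ≡ F u' v')

flipAdj : ∀ {n} → Graph n → (Fin n → Fin n → Bool) → Fin n → Fin n → Bool
flipAdj G F u v = adj G u v xor F u v

-- Reach H ℓ u v : there is a walk from u to v with at most ℓ edges in H,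
-- i.e. dist_H(u,v) ≤ ℓ (with u ≠ v steps only; loops never help).
data Reach {n : ℕ} (H : Fin n → Fin n → Bool) : ℕ → Fin n → Fin n → Set where
  here : ∀ {ℓ u} → Reach H ℓ u u
  step : ∀ {ℓ u x v} → ¬ (u ≡ x) → H u x ≡ true → Reach H ℓ x v → Reach H (suc ℓ) u v

Separated : ∀ {n} → Graph n → (Fin n → Fin n → Set) → ℕ → Fin n → Fin n → Set
Separated G R r w c =
  Σ (_ → _ → Bool) λ F → IsFlip R F × ¬ Reach (flipAdj G F) r w c

SameSClass : ∀ {n} → Graph n → List (Fin n) → Fin n → Fin n → Set
SameSClass G S u v =
  u ≡ v ⊎ ((¬ (u ∈ S)) × (¬ (v ∈ S)) × (∀ s → s ∈ S → adj G u s ≡ adj G v s))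

-- SepWins G r k S A : from the position (S_{j} = S, A_{j} = A), Separator
-- has a strategy guaranteeing that the arena becomes a singleton within
-- at most k further rounds.

data SepWins {n : ℕ} (G : Graph n) (r : ℕ) : ℕ → List (Fin n) → VSet n → Set₁ where
  done : ∀ {k S A} → Singleton A → SepWins G r k S A
  round : ∀ {k S A} →
    (∀ c → A c →
      Σ (Fin n) λ s →
        SepWins G r k (s ∷ S) (λ w → A w × ¬ Separated G (SameSClass G S) r w c)) →
    SepWins G r (suc k) S A

SeparatorWinsIn : ∀ {n} → Graph n → ℕ → ℕ → Set₁
SeparatorWinsIn G r k = SepWins G r k [] (λ _ → Data.Unit.⊤)
  where import Data.Unit

-- Pseudo-Flipper game of radius r.
-- A finite partition is given by a labelling p : V → ℕ (parts = fibres).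

SamePart : ∀ {n} → (Fin n → ℕ) → Fin n → Fin n → Set
SamePart p u v = p u ≡ p v

-- q is obtained from p by splitting one part (fibre of label ℓ) into two
-- non-empty disjoint parts X and (fibre ℓ) \ X.
Splits : ∀ {n} → (Fin n → ℕ) → (Fin n → ℕ) → Set₁
Splits {n} p q =
  Σ (Fin n → Set) λ X → Σ ℕ λ ℓ →
    (∀ x → X x → p x ≡ ℓ) ×
    (Σ (Fin n) λ x → X x) ×
    (Σ (Fin n) λ y → p y ≡ ℓ × ¬ X y) ×
    (∀ x y → (q x ≡ q y → p x ≡ p y × (X x → X y) × (X y → X x))
           × (p x ≡ p y → (X x → X y) → (X y → X x) → q x ≡ q y))

data PFWins {n : ℕ} (G : Graph n) (r : ℕ) : ℕ → (Fin n → ℕ) → VSet n → Set₁ where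
  done : ∀ {k p A} → Singleton A → PFWins G r k p A
  round : ∀ {k p A} →
    (∀ c → A c →
      Σ (Fin n → ℕ) λ q → Splits p q ×
        PFWins G r k q (λ w → A w × ¬ Separated G (SamePart p) r w c)) →
    PFWins G r (suc k) p A

PseudoFlipperWinsIn : ∀ {n} → Graph n → ℕ → ℕ → Set₁
PseudoFlipperWinsIn G r k = PFWins G r k (λ _ → 0) (λ _ → Data.Unit.⊤)
  where import Data.Unit

-- Pseudo-Flipper simulates Separator's winning strategy. He maintains a partition, labelled by
-- numbers below N, that refines the S-classes of the simulated play, so every pair r-separated
-- over S is r-separated over his partition and his arena stays inside Separator's. When
-- Separator adds s, he splits every part by adjacency to s and then isolates s: at most N + 1
-- splits, after which the labels are below 2N + 1, so k Separator rounds cost at most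
-- 2^(k+1) - 2 rounds. He must split in every round; if a split makes the partition discrete,
-- the partition before it had a single two-element part, over which any two vertices are
-- separated by a flip, so the arena collapses to Connector's vertex at once.

module Submission where

open import Defs hiding (sym)
open import Data.Nat using (ℕ; suc; _^_)
open import Data.Nat as ℕ using (zero; _+_; _*_; _<_; _≤_; _<?_; z≤n; s≤s)
open import Data.Nat.Properties
  using ( <-cmp; n<1+n; ≤-reflexive; m<1+n⇒m≤n; <-irrefl; <⇒≢; <⇒≱; <-≤-trans; m<n⇒m<1+n
        ; m≤m+n; m≤n+m; +-cancelˡ-≡; +-monoʳ-<; m^n>0; *-identityˡ; *-comm)
open import Data.Nat.Tactic.RingSolver using (solve-∀)
open import Data.Fin as Fin using (Fin)
open import Data.Fin.Properties using (any?)
open import Data.Bool as Bool using (Bool; true; false; _∧_; _xor_; if_then_else_)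
open import Data.Bool.Properties using (xor-same)
open import Data.List using (List; _∷_)
open import Data.List.Membership.Propositional using (_∈_)
open import Data.List.Relation.Unary.Any using (here; there)
open import Data.Product as Product using (Σ-syntax; ∃₂; _×_; _,_; proj₁; proj₂; map₁; swap)
open import Data.Sum as Sum using (_⊎_; inj₁; inj₂; [_,_])
open import Data.Unit using (⊤; tt)
open import Data.Empty using (⊥-elim)
open import Function using (id; _∘_; case_of_)
open import Relation.Nullary using (¬_; Dec; yes; no; does)
open import Relation.Nullary.Decidable using (decidable-stable; dec-true; dec-false; ¬?; _×-dec_; _⊎-dec_)
open import Relation.Unary using (_⊆_; Satisfiable)
open import Relation.Binary.Core using (_⇒_; _⇔_)
open import Relation.Binary.PropositionalEquality
  using (_≡_; _≢_; _≗_; refl; sym; trans; cong; subst; module ≡-Reasoning)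
open import Relation.Binary.Definitions using (tri<; tri≈; tri>)

module _ {n : ℕ} where

  Bounded : ℕ → (Fin n → ℕ) → Set
  Bounded N p = ∀ u → p u < N

  NonDiscrete : (Fin n → ℕ) → Set
  NonDiscrete p = ∃₂ λ u v → u ≢ v × p u ≡ p v

  nonDiscrete? : ∀ p → Dec (NonDiscrete p)
  nonDiscrete? p = any? λ u → any? λ v → ¬? (u Fin.≟ v) ×-dec (p u ℕ.≟ p v)

  ⇔-refl : ∀ {p : Fin n → ℕ} → SamePart p ⇔ SamePart p
  ⇔-refl = id , id

  ⇔-trans : ∀ {p q t : Fin n → ℕ} →
            SamePart p ⇔ SamePart q → SamePart q ⇔ SamePart t → SamePart p ⇔ SamePart t
  ⇔-trans (p⇒q , q⇒p) (q⇒t , t⇒q) = q⇒t ∘ p⇒q , q⇒p ∘ t⇒q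

  splits-resp-⇔ : ∀ {p p' q : Fin n → ℕ} → SamePart p ⇔ SamePart p' → Splits p q → Splits p' q
  splits-resp-⇔ (p⇒p' , p'⇒p) (X , ℓ , X⊆ℓ , (a , Xa) , (b , pb≡ℓ , ¬Xb) , iff) =
    X , _ , (λ x Xx → p⇒p' (trans (X⊆ℓ x Xx) (sym (X⊆ℓ a Xa)))) , (a , Xa)
      , (b , p⇒p' (trans pb≡ℓ (sym (X⊆ℓ a Xa))) , ¬Xb)
      , λ x y → map₁ p⇒p' ∘ proj₁ (iff x y) , proj₂ (iff x y) ∘ p'⇒p

  nonDiscrete-resp : ∀ {p q : Fin n → ℕ} → SamePart p ⇒ SamePart q → NonDiscrete p → NonDiscrete q
  nonDiscrete-resp p⇒q (u , v , u≢v , e) = u , v , u≢v , p⇒q e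

  splits⇒refines : ∀ {p q : Fin n → ℕ} → Splits p q → SamePart q ⇒ SamePart p
  splits⇒refines (_ , _ , _ , _ , _ , iff) {x} {y} = proj₁ ∘ proj₁ (iff x y)

  _[_↦_] : (Fin n → ℕ) → (Fin n → Bool) → ℕ → Fin n → ℕ
  (p [ χ ↦ new ]) u = if χ u then new else p u

  ≡true-ext : ∀ {a b : Bool} → (a ≡ true → b ≡ true) → (b ≡ true → a ≡ true) → a ≡ b
  ≡true-ext {true}  a⇒b _   = sym (a⇒b refl)
  ≡true-ext {false} {true}  _ b⇒a = b⇒a refl
  ≡true-ext {false} {false} _ _   = refl

  module Relabel {p : Fin n → ℕ} {χ : Fin n → Bool} {ℓ new : ℕ}
                 (χ⊆fibre : ∀ u → χ u ≡ true → p u ≡ ℓ) (fresh : ∀ u → p u ≢ new) where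

    relabel-kernel : SamePart (p [ χ ↦ new ]) ⇔ (λ x y → p x ≡ p y × χ x ≡ χ y)
    relabel-kernel = (λ {x} {y} → forward x y) , (λ {x} {y} (e , χe) → backward x y e χe)
      where
      forward : ∀ x y → (p [ χ ↦ new ]) x ≡ (p [ χ ↦ new ]) y → p x ≡ p y × χ x ≡ χ y
      forward x y e with χ x in χx | χ y in χy
      ... | true  | true  = trans (χ⊆fibre x χx) (sym (χ⊆fibre y χy)) , refl
      ... | true  | false = ⊥-elim (fresh y (sym e))
      ... | false | true  = ⊥-elim (fresh x e)
      ... | false | false = e , refl
      backward : ∀ x y → p x ≡ p y → χ x ≡ χ y → (p [ χ ↦ new ]) x ≡ (p [ χ ↦ new ]) y
      backward x y e χe rewrite χe with χ y
      ... | true  = refl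
      ... | false = e

    relabel-splits : ∀ {x y} → p x ≡ p y → χ x ≡ true → χ y ≡ false → Splits p (p [ χ ↦ new ])
    relabel-splits {x} {y} pxy χx χy =
      (λ u → χ u ≡ true) , ℓ , χ⊆fibre , (x , χx)
        , (y , trans (sym pxy) (χ⊆fibre x χx) , λ χy≡true → case trans (sym χy≡true) χy of λ ())
        , λ u v → (λ e → let (pe , χe) = proj₁ relabel-kernel e in pe , trans (sym χe) , trans χe)
                , λ pe u⇒v v⇒u → proj₂ relabel-kernel (pe , ≡true-ext u⇒v v⇒u)

    relabel-⇔ : (∀ {x y} → p x ≡ p y → χ x ≡ χ y) → SamePart p ⇔ SamePart (p [ χ ↦ new ])
    relabel-⇔ χ-resp = (λ e → proj₂ relabel-kernel (e , χ-resp e)) , proj₁ ∘ proj₁ relabel-kernel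

  data SplitChain : (Fin n → ℕ) → ℕ → (Fin n → ℕ) → Set₁ where
    stop  : ∀ {p t m} → SamePart p ⇔ SamePart t → SplitChain p m t
    split : ∀ {p q t m} → Splits p q → SplitChain q m t → SplitChain p (suc m) t

  chain-⇔ˡ : ∀ {p p' t m} → SamePart p ⇔ SamePart p' → SplitChain p' m t → SplitChain p m t
  chain-⇔ˡ p⇔p' (stop p'⇔t)    = stop (⇔-trans p⇔p' p'⇔t)
  chain-⇔ˡ p⇔p' (split sp rest) = split (splits-resp-⇔ (swap p⇔p') sp) rest

  chain-⇔ʳ : ∀ {p t t' m} → SplitChain p m t → SamePart t ⇔ SamePart t' → SplitChain p m t'
  chain-⇔ʳ (stop p⇔t)      t⇔t' = stop (⇔-trans p⇔t t⇔t')
  chain-⇔ʳ (split sp rest) t⇔t' = split sp (chain-⇔ʳ rest t⇔t')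

  chain-weaken : ∀ {p t m m'} → m ≤ m' → SplitChain p m t → SplitChain p m' t
  chain-weaken _         (stop p⇔t)      = stop p⇔t
  chain-weaken (s≤s m≤m') (split sp rest) = split sp (chain-weaken m≤m' rest)

  chain-snoc : ∀ {p q t m} → SplitChain p m q → SplitChain q 1 t → SplitChain p (suc m) t
  chain-snoc (stop p⇔q)      last = chain-⇔ˡ p⇔q (chain-weaken (s≤s z≤n) last)
  chain-snoc (split sp rest) last = split sp (chain-snoc rest last)

  ≗⇒⇔ : ∀ {p q : Fin n → ℕ} → p ≗ q → SamePart p ⇔ SamePart q
  ≗⇒⇔ p≗q = (λ {x} {y} e → trans (sym (p≗q x)) (trans e (p≗q y)))
          , (λ {x} {y} e → trans (p≗q x) (trans e (sym (p≗q y))))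

  relabelChain : ∀ {p χ ℓ new} → (∀ u → χ u ≡ true → p u ≡ ℓ) → (∀ u → p u ≢ new) →
                 SplitChain p 1 (p [ χ ↦ new ])
  relabelChain {p} {χ} χ⊆fibre fresh
    with any? (λ x → any? λ y → (p x ℕ.≟ p y) ×-dec (χ x Bool.≟ true) ×-dec (χ y Bool.≟ false))
  ... | yes (x , y , pxy , χx , χy) = split (relabel-splits pxy χx χy) (stop ⇔-refl)
    where open Relabel χ⊆fibre fresh
  ... | no noWitness = stop (relabel-⇔ χ-resp)
    where
    open Relabel χ⊆fibre fresh
    χ-resp : ∀ {x y} → p x ≡ p y → χ x ≡ χ y
    χ-resp {x} {y} e with χ x in χx | χ y in χy
    ... | true  | true  = refl
    ... | false | false = refl
    ... | true  | false = ⊥-elim (noWitness (x , y , e , χx , χy))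
    ... | false | true  = ⊥-elim (noWitness (y , x , sym e , χy , χx))

module _ {n : ℕ} where

  OneOf : Fin n → Fin n → Fin n → Set
  OneOf a b u = u ≡ a ⊎ u ≡ b

  PairPartition : (Fin n → ℕ) → Fin n → Fin n → Set
  PairPartition p a b = SamePart p ⇒ λ u v → u ≡ v ⊎ (OneOf a b u × OneOf a b v)

  pairPartition-swap : ∀ {p a b} → PairPartition p a b → PairPartition p b a
  pairPartition-swap pair = Sum.map₂ (Product.map Sum.swap Sum.swap) ∘ pair

  splits-discrete⇒pair : ∀ {p q} → Splits p q → ¬ NonDiscrete q →
                         ∃₂ λ a b → a ≢ b × PairPartition p a b
  splits-discrete⇒pair {p} (X , ℓ , X⊆ℓ , (a , Xa) , (b , pb≡ℓ , ¬Xb) , iff) discrete =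
    a , b , a≢b , pair
    where
    a≢b : a ≢ b
    a≢b refl = ¬Xb Xa
    injective : ∀ {u v} → p u ≡ p v → (X u → X v) → (X v → X u) → u ≡ v
    injective {u} {v} e u⇒v v⇒u with u Fin.≟ v
    ... | yes u≡v = u≡v
    ... | no u≢v  = ⊥-elim (discrete (u , v , u≢v , proj₂ (iff u v) e u⇒v v⇒u))
    fibre⊆pair : ∀ {u} → p u ≡ ℓ → OneOf a b u
    fibre⊆pair {u} pu≡ℓ with u Fin.≟ a
    ... | yes u≡a = inj₁ u≡a
    ... | no u≢a  = inj₂ (injective (trans pu≡ℓ (sym pb≡ℓ)) (⊥-elim ∘ u≢a ∘ atA) (⊥-elim ∘ ¬Xb))
      where
      atA : X u → u ≡ a
      atA Xu = injective (trans pu≡ℓ (sym (X⊆ℓ a Xa))) (λ _ → Xa) (λ _ → Xu)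
    pair : PairPartition p a b
    pair {u} {v} e with p u ℕ.≟ ℓ
    ... | yes pu≡ℓ = inj₂ (fibre⊆pair pu≡ℓ , fibre⊆pair (trans (sym e) pu≡ℓ))
    ... | no pu≢ℓ  = inj₁ (injective e (⊥-elim ∘ pu≢ℓ ∘ X⊆ℓ u) (⊥-elim ∘ pu≢ℓ ∘ trans e ∘ X⊆ℓ v))

does∧⇒ : ∀ {A : Set} (a? : Dec A) {b} → does a? ∧ b ≡ true → A
does∧⇒ (yes a) _ = a

tag : ℕ → Bool → ℕ → ℕ
tag N b x = if b then N + x else x

tag-injective : ∀ {N x y} a b → x < N → y < N → tag N a x ≡ tag N b y → a ≡ b × x ≡ y
tag-injective true  true  _   _   e = refl , +-cancelˡ-≡ _ _ _ e
tag-injective false false _   _   e = refl , e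
tag-injective true  false _   y<N e = ⊥-elim (<⇒≱ y<N (subst (_ ≤_) e (m≤m+n _ _)))
tag-injective false true  x<N _   e = ⊥-elim (<⇒≱ x<N (subst (_ ≤_) (sym e) (m≤m+n _ _)))

module Refinement {n : ℕ} (p : Fin n → ℕ) {N : ℕ} (bounded : Bounded N p) (β : Fin n → Bool) where

  -- The parts of p with label below i are split by β; the β-half of part x gets label N + x.
  partialRefine : ℕ → Fin n → ℕ
  partialRefine i u = tag N (does (p u <? i) ∧ β u) (p u)

  movedAt : ℕ → Fin n → Bool
  movedAt i u = does (p u ℕ.≟ i) ∧ β u

  partialRefine-suc : ∀ i → partialRefine (suc i) ≗ partialRefine i [ movedAt i ↦ N + i ]
  partialRefine-suc i u with <-cmp (p u) i
  ... | tri< pu<i pu≢i _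
    rewrite dec-true (p u <? suc i) (m<n⇒m<1+n pu<i) | dec-false (p u ℕ.≟ i) pu≢i
          | dec-true (p u <? i) pu<i
    = refl
  ... | tri≈ pu≮i pu≡i _
    rewrite dec-true (p u <? suc i) (s≤s (≤-reflexive pu≡i)) | dec-true (p u ℕ.≟ i) pu≡i
          | dec-false (p u <? i) pu≮i | pu≡i
    = refl
  ... | tri> pu≮i pu≢i i<pu
    rewrite dec-false (p u <? suc i) (<⇒≱ i<pu ∘ m<1+n⇒m≤n) | dec-false (p u ℕ.≟ i) pu≢i
          | dec-false (p u <? i) pu≮i
    = refl

  movedAt⊆fibre : ∀ i u → movedAt i u ≡ true → partialRefine i u ≡ i
  movedAt⊆fibre i u moved = unmoved (does∧⇒ (p u ℕ.≟ i) moved)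
    where
    unmoved : p u ≡ i → partialRefine i u ≡ i
    unmoved pu≡i rewrite dec-false (p u <? i) (<-irrefl pu≡i) = pu≡i

  p-fresh : ∀ i u → p u ≢ N + i
  p-fresh i u = <⇒≢ (<-≤-trans (bounded u) (m≤m+n N i))

  partialRefine-fresh : ∀ i u → partialRefine i u ≢ N + i
  partialRefine-fresh i u with p u <? i
  ... | no pu≮i rewrite dec-false (p u <? i) pu≮i = p-fresh i u
  ... | yes pu<i rewrite dec-true (p u <? i) pu<i with β u
  ...   | true  = <⇒≢ pu<i ∘ +-cancelˡ-≡ N _ _
  ...   | false = p-fresh i u

  partialRefineChain : ∀ i → SplitChain p i (partialRefine i)
  partialRefineChain zero    = stop ⇔-refl
  partialRefineChain (suc i) =
    chain-snoc (partialRefineChain i)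
      (chain-⇔ʳ (relabelChain (movedAt⊆fibre i) (partialRefine-fresh i))
                (≗⇒⇔ (sym ∘ partialRefine-suc i)))

  refined : Fin n → ℕ
  refined = partialRefine N

  refined-tag : ∀ u → refined u ≡ tag N (β u) (p u)
  refined-tag u rewrite dec-true (p u <? N) (bounded u) = refl

  refined-bounded : Bounded (N + N) refined
  refined-bounded u rewrite refined-tag u with β u
  ... | true  = +-monoʳ-< N (bounded u)
  ... | false = <-≤-trans (bounded u) (m≤m+n N N)

  refined-kernel : ∀ {u v} → refined u ≡ refined v → β u ≡ β v × p u ≡ p v
  refined-kernel {u} {v} e =
    tag-injective (β u) (β v) (bounded u) (bounded v)
      (trans (sym (refined-tag u)) (trans e (refined-tag v)))

module Isolation {n : ℕ} (q : Fin n → ℕ) {M : ℕ} (bounded : Bounded M q) (s : Fin n) where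

  isAt : Fin n → Bool
  isAt u = does (u Fin.≟ s)

  isolated : Fin n → ℕ
  isolated = q [ isAt ↦ M ]

  isAt⊆fibre : ∀ u → isAt u ≡ true → q u ≡ q s
  isAt⊆fibre u h with u Fin.≟ s
  ... | yes refl = refl

  isolated-bounded : Bounded (suc M) isolated
  isolated-bounded u with isAt u
  ... | true  = n<1+n M
  ... | false = m<n⇒m<1+n (bounded u)

  M-fresh : ∀ u → q u ≢ M
  M-fresh u = <⇒≢ (bounded u)

  open Relabel isAt⊆fibre M-fresh

  isolateChain : SplitChain q 1 isolated
  isolateChain = relabelChain isAt⊆fibre M-fresh

  isolate-splits : ∀ {v} → q v ≡ q s → v ≢ s → Splits q isolated
  isolate-splits {v} qv≡qs v≢s =
    relabel-splits (sym qv≡qs) (dec-true (s Fin.≟ s) refl) (dec-false (v Fin.≟ s) v≢s)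

  isolated-kernel : ∀ {u v} → isolated u ≡ isolated v → u ≡ v ⊎ (u ≢ s × v ≢ s × q u ≡ q v)
  isolated-kernel {u} {v} e with proj₁ relabel-kernel e
  ... | qe , isAt≡ with u Fin.≟ s | v Fin.≟ s
  ... | yes u≡s | yes v≡s = inj₁ (trans u≡s (sym v≡s))
  ... | no u≢s  | no v≢s  = inj₂ (u≢s , v≢s , qe)

forcedSplit : ∀ {n N} {p : Fin n → ℕ} → Bounded N p → NonDiscrete p →
              Σ[ q ∈ (Fin n → ℕ) ] Splits p q × Bounded (suc N) q
forcedSplit {p = p} bounded (u , v , u≢v , pu≡pv) =
  isolated , isolate-splits (sym pu≡pv) (u≢v ∘ sym) , isolated-bounded
  where open Isolation p bounded u

-- The double negation spares a decidability assumption on C.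
Reach-preserves-¬¬ : ∀ {n} {H : Fin n → Fin n → Bool} {C : Fin n → Set} →
  (∀ u x → C u → ¬ C x → H u x ≡ false) → ∀ {ℓ u v} → C u → Reach H ℓ u v → ¬ ¬ C v
Reach-preserves-¬¬ noExit Cu here ¬Cu = ¬Cu Cu
Reach-preserves-¬¬ {C = C} noExit {u = u} Cu (step {x = x} _ Hux rest) ¬Cv =
  ¬¬Cx λ Cx → Reach-preserves-¬¬ noExit Cx rest ¬Cv
  where
  ¬¬Cx : ¬ ¬ C x
  ¬¬Cx ¬Cx = case trans (sym Hux) (noExit u x Cu ¬Cx) of λ ()

module Separation {n : ℕ} (G : Graph n) (r : ℕ) where

  separated-antitone : ∀ {R R' : Fin n → Fin n → Set} {w c} →
                       R' ⇒ R → Separated G R r w c → Separated G R' r w c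
  separated-antitone R'⇒R (F , (F-sym , F-resp) , ¬reach) =
    F , (F-sym , λ u u' v v' uu' vv' → F-resp u u' v v' (R'⇒R uu') (R'⇒R vv')) , ¬reach

  ¬separated-refl : ∀ {R c} → ¬ Separated G R r c c
  ¬separated-refl (_ , _ , ¬reach) = ¬reach here

  cutOff : ∀ {R F} {C : Fin n → Set} {w c} → IsFlip R F → C w → ¬ C c →
           (∀ u x → C u → ¬ C x → F u x ≡ adj G u x) → Separated G R r w c
  cutOff {F = F} {C} isFlip Cw ¬Cc agree = F , isFlip , λ reach → Reach-preserves-¬¬ noExit Cw reach ¬Cc
    where
    noExit : ∀ u x → C u → ¬ C x → flipAdj G F u x ≡ false
    noExit u x Cu ¬Cx = trans (cong (adj G u x xor_) (agree u x Cu ¬Cx)) (xor-same (adj G u x))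

  -- The only part of p with two vertices is {t, t'}. The flip cuts every vertex outside {t, t'}
  -- from t, except w, which it cuts from t'; then no edge leaves {w, t}.
  module PairCut {p : Fin n → ℕ} {t t' : Fin n} (pair : PairPartition p t t')
                 (w : Fin n) (w≢t' : w ≢ t') where

    oneOf? : ∀ u → Dec (OneOf t t' u)
    oneOf? u = (u Fin.≟ t) ⊎-dec (u Fin.≟ t')

    anchor : Fin n → Fin n
    anchor v = if does (v Fin.≟ w) then t' else t

    F : Fin n → Fin n → Bool
    F u v with oneOf? u | oneOf? v
    ... | yes _ | yes _ = adj G t t'
    ... | yes _ | no _  = adj G (anchor v) v
    ... | no _  | yes _ = adj G (anchor u) u
    ... | no _  | no _  = adj G u v

    F-sym : ∀ u v → F u v ≡ F v u
    F-sym u v with oneOf? u | oneOf? v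
    ... | yes _ | yes _ = refl
    ... | yes _ | no _  = refl
    ... | no _  | yes _ = refl
    ... | no _  | no _  = Graph.sym G u v

    F-pair : ∀ {u u'} v → OneOf t t' u → OneOf t t' u' → F u v ≡ F u' v
    F-pair {u} {u'} v ou ou' with oneOf? u | oneOf? u' | oneOf? v
    ... | yes _  | yes _   | yes _ = refl
    ... | yes _  | yes _   | no _  = refl
    ... | no ¬ou | _       | _     = ⊥-elim (¬ou ou)
    ... | _      | no ¬ou' | _     = ⊥-elim (¬ou' ou')

    F-resp : ∀ {u u'} v → p u ≡ p u' → F u v ≡ F u' v
    F-resp v e with pair e
    ... | inj₁ refl       = refl
    ... | inj₂ (ou , ou') = F-pair v ou ou'

    isFlip : IsFlip (SamePart p) F
    isFlip = F-sym , λ u u' v v' uu' vv' →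
      trans (F-resp v uu') (trans (F-sym u' v) (trans (F-resp u' vv') (F-sym v' u')))

    F-from-t : ∀ x → x ≢ w → x ≢ t → F t x ≡ adj G t x
    F-from-t x x≢w x≢t with oneOf? t | oneOf? x
    ... | no ¬ot | _                = ⊥-elim (¬ot (inj₁ refl))
    ... | yes _  | yes (inj₁ x≡t)   = ⊥-elim (x≢t x≡t)
    ... | yes _  | yes (inj₂ refl)  = refl
    ... | yes _  | no _ rewrite dec-false (x Fin.≟ w) x≢w = refl

    F-from-w : ¬ OneOf t t' w → ∀ x → x ≢ t → F w x ≡ adj G w x
    F-from-w ¬ow x x≢t with oneOf? w | oneOf? x
    ... | yes ow | _               = ⊥-elim (¬ow ow)
    ... | no _   | yes (inj₁ x≡t)  = ⊥-elim (x≢t x≡t)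
    ... | no _   | yes (inj₂ refl) rewrite dec-true (w Fin.≟ w) refl = Graph.sym G t' w
    ... | no _   | no _            = refl

    agree : ∀ u x → OneOf w t u → ¬ OneOf w t x → F u x ≡ adj G u x
    agree u x (inj₂ refl) ¬Cx = F-from-t x (¬Cx ∘ inj₁) (¬Cx ∘ inj₂)
    agree u x (inj₁ refl) ¬Cx = fromW (oneOf? w)
      where
      fromW : Dec (OneOf t t' w) → F w x ≡ adj G w x
      fromW (yes (inj₁ w≡t))  =
        subst (λ z → F z x ≡ adj G z x) (sym w≡t) (F-from-t x (¬Cx ∘ inj₁) (¬Cx ∘ inj₂))
      fromW (yes (inj₂ w≡t')) = ⊥-elim (w≢t' w≡t')
      fromW (no ¬ow)          = F-from-w ¬ow x (¬Cx ∘ inj₂)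

    cut : ∀ {c} → w ≢ c → t ≢ c → Separated G (SamePart p) r w c
    cut w≢c t≢c = cutOff {C = OneOf w t} isFlip (inj₁ refl) [ w≢c ∘ sym , t≢c ∘ sym ] agree

  pair⇒separated : ∀ {p a b w c} → a ≢ b → PairPartition p a b → w ≢ c →
                   Separated G (SamePart p) r w c
  pair⇒separated {a = a} {b} {w} {c} a≢b pair w≢c with w Fin.≟ b | c Fin.≟ a
  ... | yes w≡b | _       = PairCut.cut (pairPartition-swap pair) w
                              (λ w≡a → a≢b (trans (sym w≡a) w≡b)) w≢c (λ b≡c → w≢c (trans w≡b b≡c))
  ... | no _    | yes c≡a = PairCut.cut (pairPartition-swap pair) w
                              (λ w≡a → w≢c (trans w≡a (sym c≡a))) w≢c
                              (λ b≡c → a≢b (trans (sym c≡a) (sym b≡c)))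
  ... | no w≢b  | no c≢a  = PairCut.cut pair w w≢b w≢c (c≢a ∘ sym)

  splits-discrete⇒separated : ∀ {p q w c} → Splits p q → ¬ NonDiscrete q → w ≢ c →
                              Separated G (SamePart p) r w c
  splits-discrete⇒separated sp discrete with splits-discrete⇒pair sp discrete
  ... | _ , _ , a≢b , pair = pair⇒separated a≢b pair

budget : ℕ → ℕ → ℕ
budget zero    N = 0
budget (suc k) N = suc (N + budget k (suc (N + N)))

budget-closed : ∀ k N → budget k N + suc N ≡ 2 ^ k * suc N
budget-closed zero    N = sym (*-identityˡ (suc N))
budget-closed (suc k) N = begin
  suc (N + budget k M) + suc N ≡⟨ regroup N (budget k M) ⟩
  budget k M + suc M           ≡⟨ budget-closed k M ⟩
  2 ^ k * suc M                ≡⟨ double (2 ^ k) N ⟩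
  2 ^ suc k * suc N            ∎
  where
  open ≡-Reasoning
  M : ℕ
  M = suc (N + N)
  regroup : ∀ N b → suc (N + b) + suc N ≡ b + suc (suc (N + N))
  regroup = solve-∀
  double : ∀ x N → x * suc (suc (N + N)) ≡ 2 * x * suc N
  double = solve-∀

budget-bound : ∀ k → budget k 1 ≤ 2 ^ suc k
budget-bound k =
  subst (budget k 1 ≤_) (trans (budget-closed k 1) (*-comm (2 ^ k) 2)) (m≤m+n (budget k 1) 2)

module _ {n : ℕ} where

  -- Pseudo-Flipper has to split a part in every round, so while the arena has two vertices
  -- some part of his partition must have two vertices.
  Playable : (Fin n → ℕ) → VSet n → Set
  Playable p A = Singleton A ⊎ NonDiscrete p

  singleton-⊆ : ∀ {A A' : VSet n} → Singleton A → A' ⊆ A → Satisfiable A' → Singleton A'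
  singleton-⊆ (_ , _ , unique) A'⊆A (x , A'x) =
    x , A'x , λ y A'y → trans (unique y (A'⊆A A'y)) (sym (unique x (A'⊆A A'x)))

module Game {n : ℕ} (G : Graph n) (r : ℕ) where
  open Separation G r

  survivors : (Fin n → ℕ) → VSet n → Fin n → VSet n
  survivors p A c w = A w × ¬ Separated G (SamePart p) r w c

  PFWins-mono : ∀ {k k' p A} → k ≤ k' → PFWins G r k p A → PFWins G r k' p A
  PFWins-mono _          (done sg)        = done sg
  PFWins-mono (s≤s k≤k') (round strategy) = round λ c Ac →
    let (q , sp , win) = strategy c Ac in q , sp , PFWins-mono k≤k' win

  PFWins-resp : ∀ {k p p' A A'} → SamePart p ⇔ SamePart p' → A' ⊆ A → Satisfiable A' →
                PFWins G r k p A → PFWins G r k p' A'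
  PFWins-resp _   A'⊆A satA' (done sg)        = done (singleton-⊆ sg A'⊆A satA')
  PFWins-resp p⇔p' A'⊆A _    (round strategy) = round λ c A'c →
    let (q , sp , win) = strategy c (A'⊆A A'c) in
    q , splits-resp-⇔ p⇔p' sp
      , PFWins-resp ⇔-refl (λ (A'w , ¬sep) → A'⊆A A'w , ¬sep ∘ separated-antitone (proj₂ p⇔p'))
                    (c , A'c , ¬separated-refl) win

  playable-after : ∀ {p q A c} → Splits p q → A c → Playable q (survivors p A c)
  playable-after {q = q} {c = c} sp Ac with nonDiscrete? q
  ... | yes nonDiscrete = inj₂ nonDiscrete
  ... | no discrete     = inj₁ (c , (Ac , ¬separated-refl) , λ w (_ , ¬sep) →
      decidable-stable (w Fin.≟ c) (¬sep ∘ splits-discrete⇒separated sp discrete))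

  WinsFrom : ℕ → (Fin n → ℕ) → VSet n → Set₁
  WinsFrom k p U = ∀ {A} → A ⊆ U → Satisfiable A → Playable p A → PFWins G r k p A

  playChain : ∀ {p t m k U} → SplitChain p m t → WinsFrom k t U → WinsFrom (m + k) p U
  playChain {m = m} (stop p⇔t) win A⊆U satA playable =
    PFWins-mono (m≤n+m _ m)
      (PFWins-resp (swap p⇔t) id satA
        (win A⊆U satA (Sum.map₂ (nonDiscrete-resp (proj₁ p⇔t)) playable)))
  playChain (split sp rest) win A⊆U _ _ = round λ c Ac →
    _ , sp , playChain rest win (λ (Aw , _) → A⊆U Aw) (c , Ac , ¬separated-refl)
                       (playable-after sp Ac)

  sameSClass-∷ : ∀ {S s u v} → u ≢ s → v ≢ s → adj G u s ≡ adj G v s →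
                 SameSClass G S u v → SameSClass G (s ∷ S) u v
  sameSClass-∷ _   _   _    (inj₁ u≡v)                 = inj₁ u≡v
  sameSClass-∷ {S} {s} {u} {v} u≢s v≢s adj≡ (inj₂ (u∉S , v∉S , agree)) =
    inj₂ (∉-∷ u≢s u∉S , ∉-∷ v≢s v∉S , agree-∷)
    where
    ∉-∷ : ∀ {x} {S : List (Fin n)} {s} → x ≢ s → ¬ x ∈ S → ¬ x ∈ s ∷ S
    ∉-∷ x≢s _   (here x≡s)  = x≢s x≡s
    ∉-∷ _   x∉S (there x∈S) = x∉S x∈S
    agree-∷ : ∀ s' → s' ∈ s ∷ S → adj G u s' ≡ adj G v s'
    agree-∷ _ (here refl)  = adj≡
    agree-∷ s' (there s'∈S) = agree s' s'∈S

  refineAndIsolate : ∀ {S N p} → Bounded N p → SamePart p ⇒ SameSClass G S → (s : Fin n) →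
                     Σ[ t ∈ (Fin n → ℕ) ]
                       SplitChain p (suc N) t × Bounded (suc (N + N)) t
                       × SamePart t ⇒ SameSClass G (s ∷ S)
  refineAndIsolate {S} {N} {p} bounded p⇒S s =
    isolated , chain-snoc (partialRefineChain N) isolateChain , isolated-bounded , isolated⇒S
    where
    open Refinement p bounded (λ u → adj G u s)
    open Isolation refined refined-bounded s
    isolated⇒S : SamePart isolated ⇒ SameSClass G (s ∷ S)
    isolated⇒S e with isolated-kernel e
    ... | inj₁ u≡v                 = inj₁ u≡v
    ... | inj₂ (u≢s , v≢s , refinedEq) =
      let (adjEq , pEq) = refined-kernel refinedEq in sameSClass-∷ u≢s v≢s adjEq (p⇒S pEq)

  stage : ∀ {S N p} → Bounded N p → SamePart p ⇒ SameSClass G S → NonDiscrete p → (s : Fin n) →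
          Σ[ q ∈ (Fin n → ℕ) ] Σ[ t ∈ (Fin n → ℕ) ]
            Splits p q × SplitChain q N t × Bounded (suc (N + N)) t
            × SamePart t ⇒ SameSClass G (s ∷ S)
  stage {N = N} bounded p⇒S nonDiscrete s with refineAndIsolate bounded p⇒S s
  ... | t , split sp chain , t-bounded , t⇒S = _ , t , sp , chain , t-bounded , t⇒S
  ... | t , stop p⇔t       , _         , t⇒S =
    let (q , sp , q-bounded) = forcedSplit bounded nonDiscrete in
    q , q , sp , stop ⇔-refl , (λ u → <-≤-trans (q-bounded u) (s≤s (m≤m+n N N)))
      , t⇒S ∘ proj₁ p⇔t ∘ splits⇒refines sp

  simulate : ∀ {k S U N p} → SepWins G r k S U → Bounded N p → SamePart p ⇒ SameSClass G S →
             WinsFrom (budget k N) p U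
  simulate (done sg)        _       _   A⊆U satA _ = done (singleton-⊆ sg A⊆U satA)
  simulate (round _)        _       _   _   _    (inj₁ sg) = done sg
  simulate (round strategy) bounded p⇒S A⊆U _    (inj₂ nonDiscrete) = round λ c Ac →
    let (s , next) = strategy c (A⊆U Ac)
        (q , t , sp , chain , t-bounded , t⇒S) = stage bounded p⇒S nonDiscrete s
    in q , sp , playChain chain (simulate next t-bounded t⇒S)
                  (λ (Aw , ¬sep) → A⊆U Aw , ¬sep ∘ separated-antitone p⇒S)
                  (c , Ac , ¬separated-refl) (playable-after sp Ac)

initiallyPlayable : ∀ m → Playable {suc m} (λ _ → 0) (λ _ → ⊤)
initiallyPlayable zero    = inj₁ (Fin.zero , tt , λ { Fin.zero _ → refl })
initiallyPlayable (suc m) = inj₂ (Fin.zero , Fin.suc Fin.zero , (λ ()) , refl)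

mainTheorem9 : ∀ (r : ℕ) {n : ℕ} (G : Graph n) (k : ℕ) →
    SeparatorWinsIn G r k → PseudoFlipperWinsIn G r (2 ^ suc k)
mainTheorem9 r {zero} G k _ = PFWins-mono (m^n>0 2 (suc k)) (round λ ())
  where open Game G r
mainTheorem9 r {suc m} G k separatorWins =
  PFWins-mono (budget-bound k)
    (simulate separatorWins (λ _ → s≤s z≤n) (λ _ → inj₂ ((λ ()) , (λ ()) , λ _ ()))
              id (Fin.zero , tt) (initiallyPlayable m))
  where open Game G r
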